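{- Let $G$ be a graph, $X_1\subseteq X\subseteq V(G)$, let $(\bar a,\bar b)$ be an ordered split pair for $X$ and $(\bar a_1,\bar b_1)$ an ordered split pair for $X_1$ such that $X_1\cap\bar a\subseteq\bar a_1$. Let $v,w\in X_1$ with $v\approx_{(\bar a_1,\bar b_1)}w$. Then $v\approx_{(\bar a,\bar b)}w$.
   Context: Graphs are finite, simple, undirected; $N(v)$ is the neighbourhood and $\overline Y=V(G)\setminus Y$. For $v\in Y$, $\mathbf x_Y(v)\in\mathbb F_2^{\overline Y}$ has $w$-entry $1$ iff $vw\in E(G)$. A split pair for $Y$ is $(A,B)$ with $A\subseteq Y$, $B\subseteq\overline Y$, $\{\mathbf x_Y(a)\mid a\in A\}$ a basis of the $\mathbb F_2$-span of $\{\mathbf x_Y(v)\mid v\in Y\}$ and $\{\mathbf x_{\overline Y}(b)\mid b\in B\}$ a basis of the span of $\{\mathbf x_{\overline Y}(v)\mid v\in\overline Y\}$; an ordered split pair is a pair of tuples whose entry sets form a split pair. Tuples are identified with their sets of entries in set expressions. $v\approx_{(\bar a,\bar b)}w$ means $N(v)\cap(\bar a,\bar b)=N(w)\cap(\bar a,\bar b)$, i.e. $v$ and $w$ have the same neighbours among the entries of $\bar a$ and $\bar b$. -}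

module Defs where

open import Data.Bool using (Bool; true; false; if_then_else_; _xor_)
open import Data.Nat using (ℕ)
open import Data.Fin using (Fin; zero; suc)
open import Data.Fin.Subset using (Subset; _∈_; _∉_; _⊆_; ∁; _∪_; ⁅_⁆; ⊥)
open import Data.Vec using (Vec; []; _∷_; lookup)
open import Data.Product using (_×_; ∃)
open import Relation.Binary.PropositionalEquality using (_≡_)
open import Relation.Nullary using (¬_)

record Graph (n : ℕ) : Set where
  field
    adj   : Fin n → Fin n → Bool
    sym   : ∀ u v → adj u v ≡ adj v u
    irrefl : ∀ v → adj v v ≡ false

open Graph public

F2Vec : ℕ → Set
F2Vec n = Fin n → Bool

zeroVec : ∀ {n} → F2Vec n
zeroVec _ = false

_⊕_ : ∀ {n} → F2Vec n → F2Vec n → F2Vec n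
(f ⊕ g) w = f w xor g w

_≐_ : ∀ {n} → F2Vec n → F2Vec n → Set
f ≐ g = ∀ w → f w ≡ g w

-- x_Y(v) ∈ F₂^{V∖Y}, represented as a vector in F₂^{V(G)} whose
-- coordinates at vertices of Y are fixed to 0 (the canonical copy of F₂^{V∖Y}).
xvec : ∀ {n} → Graph n → Subset n → Fin n → F2Vec n
xvec G Y v w = if lookup Y w then false else adj G v w

sumOver : ∀ {n m} → Subset n → (Fin n → F2Vec m) → F2Vec m
sumOver []            f = zeroVec
sumOver (true  ∷ T) f = f zero ⊕ sumOver T (λ i → f (suc i))
sumOver (false ∷ T) f = sumOver T (λ i → f (suc i))

Spans : ∀ {n} → Graph n → Subset n → Subset n → Set
Spans G Y A = ∀ v → v ∈ Y → ∃ λ T → T ⊆ A × (sumOver T (xvec G Y) ≐ xvec G Y v)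

-- The SET {x_Y(a) | a ∈ A} is linearly independent: any subset T ⊆ A
-- indexing pairwise distinct vectors with zero sum is empty.
Independent : ∀ {n} → Graph n → Subset n → Subset n → Set
Independent G Y A =
  ∀ T → T ⊆ A →
  (∀ a b → a ∈ T → b ∈ T → xvec G Y a ≐ xvec G Y b → a ≡ b) →
  sumOver T (xvec G Y) ≐ zeroVec →
  T ≡ ⊥

IsBasis : ∀ {n} → Graph n → Subset n → Subset n → Set
IsBasis G Y A = Spans G Y A × Independent G Y A

SplitPair : ∀ {n} → Graph n → Subset n → Subset n → Subset n → Set
SplitPair G Y A B = A ⊆ Y × B ⊆ ∁ Y × IsBasis G Y A × IsBasis G (∁ Y) B

entries : ∀ {n k} → Vec (Fin n) k → Subset n
entries []       = ⊥
entries (x ∷ xs) = ⁅ x ⁆ ∪ entries xs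

OrderedSplitPair : ∀ {n k l} → Graph n → Subset n → Vec (Fin n) k → Vec (Fin n) l → Set
OrderedSplitPair G Y as bs = SplitPair G Y (entries as) (entries bs)

SameType : ∀ {n k l} → Graph n → Vec (Fin n) k → Vec (Fin n) l → Fin n → Fin n → Set
SameType G as bs v w = ∀ u → u ∈ entries as ∪ entries bs → adj G v u ≡ adj G w u

module Submission where

-- Write C = V(G) ∖ X₁.  Since (ā₁, b̄₁) is a split pair for X₁,
-- every vector x_C(u) with u ∈ C is an F₂-sum of vectors x_C(b) with b ∈ b̄₁.
-- For v, w ∈ X₁ the v- and w-coordinates of x_C(u) are just adjacencies, so if
-- v and w have the same neighbours in b̄₁ they have the same neighbours in all
-- of C (lemma `agreement-spreads`).  It then suffices to see that every entry
-- of ā or b̄ lies in ā₁ or in C (lemma `entries-covered`): entries of b̄ lie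
-- outside X ⊇ X₁, and an entry of ā either lies in X₁ (hence in ā₁ by
-- hypothesis) or in C.

open import Defs
open import Data.Bool using (true; false; _xor_)
open import Data.Bool.Properties using (¬-not)
open import Data.Fin using (Fin; zero; suc)
open import Data.Fin.Subset using (Subset; _∈_; _∉_; _⊆_; _∩_; _∪_; ∁)
open import Data.Fin.Subset.Properties
  using (_∈?_; x∈p∪q⁺; x∈p∪q⁻; x∈p∩q⁺; x∈p⇒x∉∁p; x∉p⇒x∈∁p; p⊆q⇒∁p⊇∁q)
open import Data.Vec using (Vec; []; _∷_; lookup)
open import Data.Vec.Base using (_[_]=_)
open _[_]=_ using (here; there)
open import Data.Vec.Properties using (lookup⇒[]=)
open import Data.Product using (_,_)
open import Data.Sum using (_⊎_; inj₁; inj₂)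
open import Relation.Binary.PropositionalEquality using (_≡_; refl; cong₂; module ≡-Reasoning)
open import Relation.Nullary using (yes; no)

lookup-∉ : ∀ {n} {Y : Subset n} {w : Fin n} → w ∉ Y → lookup Y w ≡ false
lookup-∉ {Y = Y} {w} w∉Y = ¬-not (λ eq → w∉Y (lookup⇒[]= w Y eq))

xvec-coordinate : ∀ {n} (G : Graph n) (Y : Subset n) (u : Fin n) {w : Fin n} →
  w ∉ Y → xvec G Y u w ≡ adj G u w
xvec-coordinate G Y u {w} w∉Y rewrite lookup-∉ w∉Y = refl

sumOver-coordinates : ∀ {n m} (T : Subset n) (f : Fin n → F2Vec m) (v w : Fin m) →
  (∀ i → i ∈ T → f i v ≡ f i w) → sumOver T f v ≡ sumOver T f w
sumOver-coordinates []          f v w agree = refl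
sumOver-coordinates (true ∷ T)  f v w agree =
  cong₂ _xor_ (agree zero here)
    (sumOver-coordinates T (λ i → f (suc i)) v w (λ i i∈T → agree (suc i) (there i∈T)))
sumOver-coordinates (false ∷ T) f v w agree =
  sumOver-coordinates T (λ i → f (suc i)) v w (λ i i∈T → agree (suc i) (there i∈T))

agreement-spreads : ∀ {n} (G : Graph n) (Y A : Subset n) → Spans G Y A →
  {v w : Fin n} → v ∉ Y → w ∉ Y →
  (∀ a → a ∈ A → adj G v a ≡ adj G w a) →
  ∀ u → u ∈ Y → adj G v u ≡ adj G w u
agreement-spreads G Y A spans {v} {w} v∉Y w∉Y agreeOnA u u∈Y
  with spans u u∈Y
... | T , T⊆A , sum≐ = begin
  adj G v u                    ≡⟨ Graph.sym G v u ⟩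
  adj G u v                    ≡⟨ xvec-coordinate G Y u v∉Y ⟨
  xvec G Y u v                 ≡⟨ sum≐ v ⟨
  sumOver T (xvec G Y) v       ≡⟨ sumOver-coordinates T (xvec G Y) v w summandsAgree ⟩
  sumOver T (xvec G Y) w       ≡⟨ sum≐ w ⟩
  xvec G Y u w                 ≡⟨ xvec-coordinate G Y u w∉Y ⟩
  adj G u w                    ≡⟨ Graph.sym G u w ⟩
  adj G w u                    ∎
  where
  open ≡-Reasoning
  summandsAgree : ∀ i → i ∈ T → xvec G Y i v ≡ xvec G Y i w
  summandsAgree i i∈T = begin
    xvec G Y i v  ≡⟨ xvec-coordinate G Y i v∉Y ⟩
    adj G i v     ≡⟨ Graph.sym G i v ⟩
    adj G v i     ≡⟨ agreeOnA i (T⊆A i∈T) ⟩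
    adj G w i     ≡⟨ Graph.sym G w i ⟩
    adj G i w     ≡⟨ xvec-coordinate G Y i w∉Y ⟨
    xvec G Y i w  ∎

entries-covered : ∀ {n} {X X₁ A B A₁ : Subset n} →
  X₁ ⊆ X → B ⊆ ∁ X → X₁ ∩ A ⊆ A₁ →
  ∀ {u} → u ∈ A ∪ B → u ∈ A₁ ⊎ u ∈ ∁ X₁
entries-covered {X₁ = X₁} {A} {B} X₁⊆X B⊆∁X X₁A⊆A₁ {u} u∈A∪B
  with x∈p∪q⁻ A B u∈A∪B
... | inj₂ u∈B = inj₂ (p⊆q⇒∁p⊇∁q X₁⊆X (B⊆∁X u∈B))
... | inj₁ u∈A with u ∈? X₁
...   | yes u∈X₁ = inj₁ (X₁A⊆A₁ (x∈p∩q⁺ (u∈X₁ , u∈A)))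
...   | no  u∉X₁ = inj₂ (x∉p⇒x∈∁p u∉X₁)

lemma5p7 : ∀ {n k l k₁ l₁} (G : Graph n) (X X₁ : Subset n) →
    X₁ ⊆ X →
    (as : Vec (Fin n) k) (bs : Vec (Fin n) l) →
    (as₁ : Vec (Fin n) k₁) (bs₁ : Vec (Fin n) l₁) →
    OrderedSplitPair G X as bs →
    OrderedSplitPair G X₁ as₁ bs₁ →
    X₁ ∩ entries as ⊆ entries as₁ →
    (v w : Fin n) → v ∈ X₁ → w ∈ X₁ →
    SameType G as₁ bs₁ v w →
    SameType G as bs v w
lemma5p7 G X X₁ X₁⊆X as bs as₁ bs₁ (_ , bs⊆∁X , _) (_ , _ , _ , (spans₁ , _))
         X₁as⊆as₁ v w v∈X₁ w∈X₁ sameType₁ u u∈entries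
  with entries-covered X₁⊆X bs⊆∁X X₁as⊆as₁ u∈entries
... | inj₁ u∈as₁ = sameType₁ u (x∈p∪q⁺ (inj₁ u∈as₁))
... | inj₂ u∈∁X₁ =
  agreement-spreads G (∁ X₁) (entries bs₁) spans₁
    (x∈p⇒x∉∁p v∈X₁) (x∈p⇒x∉∁p w∈X₁)
    (λ b b∈bs₁ → sameType₁ b (x∈p∪q⁺ (inj₂ b∈bs₁)))
    u u∈∁X₁
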